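{- For positive integers $r,n$, define $$A_{n}^{(r)}(x,y,s,t,p,q)=\sum_{\pi^c\in\mathbb{Z}_r\wr\mathcal{S}_n}x^{\mathrm{exc}_A(\pi^c)}y^{\mathrm{aexc}_A(\pi^c)}s^{\mathrm{single}(\pi^c)}t^{\mathrm{fix}(\pi^c)}p^{\mathrm{csum}(\pi^c)}q^{\mathrm{cyc}(\pi^c)}.$$ Then $$A_{n}^{(r)}(x,y,s,t,p,q)=\sum_{\pi\in\mathcal{S}_n}(x+p[r-1]_py)^{\mathrm{exc}(\pi)}([r]_py)^{\mathrm{drop}(\pi)}(t+sp[r-1]_p)^{\mathrm{fix}(\pi)}q^{\mathrm{cyc}(\pi)},$$ equivalently $$A_{n}^{(r)}(x,y,s,t,p,q)=[r]_p^ny^nA_n\left(\frac{x+p[r-1]_py}{[r]_py},\frac{t+sp[r-1]_p}{[r]_py},q\right).$$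
   Context: $[m]_p=1+p+\cdots+p^{m-1}$ for $m\geqslant1$, $[0]_p=0$. $A_n(x,p,q)=\sum_{\pi\in\mathcal{S}_n}x^{\mathrm{exc}(\pi)}p^{\mathrm{fix}(\pi)}q^{\mathrm{cyc}(\pi)}$, where for $\pi\in\mathcal{S}_n$, $\mathrm{exc}(\pi)=\#\{i:\pi(i)>i\}$, $\mathrm{drop}(\pi)=\#\{i:\pi(i)<i\}$, $\mathrm{fix}(\pi)=\#\{i:\pi(i)=i\}$, $\mathrm{cyc}$ the number of cycles. $\mathbb{Z}_r\wr\mathcal{S}_n$ is the set of $r$-colored permutations $\pi^c=\pi_1^{c_1}\cdots\pi_n^{c_n}$ with $\pi\in\mathcal{S}_n$, $c_i\in\{0,\dots,r-1\}$. Statistics: $\mathrm{exc}_A(\pi^c)=\#\{i:c_i=0,\ \pi_i>i\}$; $\mathrm{fix}(\pi^c)=\#\{i:\pi_i=i,\ c_i=0\}$; $\mathrm{single}(\pi^c)=\#\{i:\pi_i=i,\ c_i>0\}$; $\mathrm{aexc}_A(\pi^c)=n-\mathrm{exc}_A(\pi^c)-\mathrm{fix}(\pi^c)-\mathrm{single}(\pi^c)$ (the number of $i$ with either $c_i=0$ and $\pi_i<i$, or $c_i>0$ and $\pi_i\neq i$); $\mathrm{csum}(\pi^c)=\sum_ic_i$; $\mathrm{cyc}(\pi^c)$ is the number of cycles of $\pi$. -}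

module Defs where

open import Level using (Level)
open import Data.Bool using (Bool; true; false; _∧_; not; if_then_else_)
open import Data.Nat using (ℕ; zero; suc; _∸_; _≤ᵇ_; _<ᵇ_; _≡ᵇ_)
import Data.Nat as N
open import Data.Fin using (Fin; toℕ)
open import Data.List using (List; []; _∷_; map; concatMap; allFin; filterᵇ; length; upTo; foldr)
open import Data.Bool.ListAction using (and)
open import Data.Vec.Functional using () renaming (_∷_ to _∷ᶠ_)
open import Algebra.Bundles using (CommutativeRing)

allFuns : (m k : ℕ) → List (Fin m → Fin k)
allFuns zero    k = (λ ()) ∷ []
allFuns (suc m) k = concatMap (λ a → map (λ f → a ∷ᶠ f) (allFuns m k)) (allFin k)

isInjᵇ : {n : ℕ} → (Fin n → Fin n) → Bool
isInjᵇ {n} f = and (map (λ i → and (map (λ j →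
  if toℕ (f i) ≡ᵇ toℕ (f j) then toℕ i ≡ᵇ toℕ j else true) (allFin n))) (allFin n))

-- the symmetric group S_n: all bijections Fin n → Fin n (injective = bijective on Fin n)
perms : (n : ℕ) → List (Fin n → Fin n)
perms n = filterᵇ isInjᵇ (allFuns n n)

colourings : (n r : ℕ) → List (Fin n → Fin r)
colourings n r = allFuns n r

count : {n : ℕ} → (Fin n → Bool) → ℕ
count {n} b = length (filterᵇ b (allFin n))

iter : {n : ℕ} → (Fin n → Fin n) → ℕ → Fin n → Fin n
iter π zero    i = i
iter π (suc k) i = π (iter π k i)

isCycMin : {n : ℕ} → (Fin n → Fin n) → Fin n → Bool
isCycMin {n} π i = and (map (λ k → toℕ i ≤ᵇ toℕ (iter π k i)) (upTo n))

exc drop fix cyc : {n : ℕ} → (Fin n → Fin n) → ℕ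
exc  π = count (λ i → toℕ i <ᵇ toℕ (π i))
drop π = count (λ i → toℕ (π i) <ᵇ toℕ i)
fix  π = count (λ i → toℕ (π i) ≡ᵇ toℕ i)
-- number of cycles = number of cycle minima (one per cycle)
cyc  π = count (isCycMin π)

-- coloured permutation statistics (π, c) ≙ π_1^{c_1} … π_n^{c_n}
excA fixC single aexcA csum : {n r : ℕ} → (Fin n → Fin n) → (Fin n → Fin r) → ℕ
excA   π c = count (λ i → (toℕ (c i) ≡ᵇ 0) ∧ (toℕ i <ᵇ toℕ (π i)))
fixC   π c = count (λ i → (toℕ (π i) ≡ᵇ toℕ i) ∧ (toℕ (c i) ≡ᵇ 0))
single π c = count (λ i → (toℕ (π i) ≡ᵇ toℕ i) ∧ not (toℕ (c i) ≡ᵇ 0))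
aexcA {n} π c = n ∸ excA π c ∸ fixC π c ∸ single π c
csum {n} π c = foldr N._+_ 0 (map (λ i → toℕ (c i)) (allFin n))

module RingDefs {c ℓ : Level} (R : CommutativeRing c ℓ) where
  open CommutativeRing R

  pow : Carrier → ℕ → Carrier
  pow a zero    = 1#
  pow a (suc k) = a * pow a k

  Σl : {A : Set} → List A → (A → Carrier) → Carrier
  Σl xs f = foldr (λ a acc → f a + acc) 0# xs

  -- [m]_p = 1 + p + … + p^{m-1}, [0]_p = 0
  qint : ℕ → Carrier → Carrier
  qint m p = Σl (upTo m) (λ k → pow p k)

  Ar : (n r : ℕ) → (x y s t p q : Carrier) → Carrier
  Ar n r x y s t p q = Σl (perms n) (λ π → Σl (colourings n r) (λ c →
    pow x (excA π c) * pow y (aexcA π c) * pow s (single π c) *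
    pow t (fixC π c) * pow p (csum π c) * pow q (cyc π)))

  RHS : (n r : ℕ) → (x y s t p q : Carrier) → Carrier
  RHS n r x y s t p q = Σl (perms n) (λ π →
    pow (x + p * qint (r ∸ 1) p * y) (exc π) *
    pow (qint r p * y) (drop π) *
    pow (t + s * p * qint (r ∸ 1) p) (fix π) *
    pow q (cyc π))

module Submission where

open import Defs
open import Level using (Level)
open import Data.Nat using (ℕ; _≤_; zero; suc)
import Data.Nat as ℕ
import Data.Nat.Properties as ℕₚ
open import Algebra.Bundles using (CommutativeRing)
open import Data.Bool using (Bool; true; false; if_then_else_)
open import Data.Fin using (Fin; toℕ; zero; suc)
open import Data.List using (List; []; _∷_; map; concatMap; tabulate; applyUpTo; _++_; allFin)
open import Data.Vec.Functional using () renaming (_∷_ to _∷ᶠ_)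
open import Function using (_∘_; id)
open import Relation.Binary.PropositionalEquality using (_≡_; cong)
open import Algebra.Properties.CommutativeMonoid.Sum ℕₚ.+-0-commutativeMonoid as ℕ∑ using ()

-- For fixed π, the weight of a coloured permutation (π, c) is a product over the
-- positions i of a factor that depends only on the colour c_i (through p^{c_i} and
-- whether c_i = 0) and on whether i is an excedance, a fixed point or a drop of π.
-- The sum over c therefore factorises into a product of sums over a single colour
-- k < r: an excedance contributes x + y(p + ⋯ + p^{r-1}), a drop y(1 + ⋯ + p^{r-1})
-- and a fixed point t + s(p + ⋯ + p^{r-1}). Since aexc_A is defined by subtraction,
-- one first shows that it counts the positions where none of exc_A, fix, single holds.

module Counting where
  open import Data.Nat using (_+_; _∸_; _<ᵇ_; _≡ᵇ_)
  open import Data.Bool using (_∧_; _∨_; not)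
  open import Data.List using (filterᵇ; length; foldr)
  open import Relation.Binary.PropositionalEquality using (refl; cong₂; sym; module ≡-Reasoning)

  data Trichotomous : Bool → Bool → Bool → Set where
    less    : Trichotomous true false false
    equal   : Trichotomous false true false
    greater : Trichotomous false false true

  trichotomous : ∀ m n → Trichotomous (m <ᵇ n) (n ≡ᵇ m) (n <ᵇ m)
  trichotomous zero    zero    = equal
  trichotomous zero    (suc n) = less
  trichotomous (suc m) zero    = greater
  trichotomous (suc m) (suc n) = trichotomous m n

  isExc isFix isDrop : ∀ {n} → (Fin n → Fin n) → Fin n → Bool
  isExc  π i = toℕ i <ᵇ toℕ (π i)
  isFix  π i = toℕ (π i) ≡ᵇ toℕ i
  isDrop π i = toℕ (π i) <ᵇ toℕ i

  isUncoloured : ∀ {n r} → (Fin n → Fin r) → Fin n → Bool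
  isUncoloured c i = toℕ (c i) ≡ᵇ 0

  excᵇ fixᵇ singleᵇ aexcᵇ : (l e z : Bool) → Bool
  excᵇ    l e z = z ∧ l
  fixᵇ    l e z = e ∧ z
  singleᵇ l e z = e ∧ not z
  aexcᵇ   l e z = not (excᵇ l e z ∨ fixᵇ l e z ∨ singleᵇ l e z)

  indicator : Bool → ℕ
  indicator b = if b then 1 else 0

  indicator-partition : ∀ {l e g} → Trichotomous l e g → ∀ z →
    indicator (excᵇ l e z) + indicator (fixᵇ l e z) + indicator (singleᵇ l e z) + indicator (aexcᵇ l e z) ≡ 1
  indicator-partition less    true  = refl
  indicator-partition less    false = refl
  indicator-partition equal   true  = refl
  indicator-partition equal   false = refl
  indicator-partition greater true  = refl
  indicator-partition greater false = refl

  length-filterᵇ-tabulate : ∀ {n} {A : Set} (b : A → Bool) (h : Fin n → A) →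
    length (filterᵇ b (tabulate h)) ≡ ℕ∑.sum (indicator ∘ b ∘ h)
  length-filterᵇ-tabulate {zero}  b h = refl
  length-filterᵇ-tabulate {suc n} b h with b (h zero)
  ... | true  = cong suc (length-filterᵇ-tabulate b (h ∘ suc))
  ... | false = length-filterᵇ-tabulate b (h ∘ suc)

  count≡sum : ∀ {n} (b : Fin n → Bool) → count b ≡ ℕ∑.sum (indicator ∘ b)
  count≡sum b = length-filterᵇ-tabulate b id

  sum-ones : ∀ n → ℕ∑.sum {n} (λ _ → 1) ≡ n
  sum-ones zero    = refl
  sum-ones (suc n) = cong suc (sum-ones n)

  count-partition : ∀ {n} (b₁ b₂ b₃ b₄ : Fin n → Bool) →
    (∀ i → indicator (b₁ i) + indicator (b₂ i) + indicator (b₃ i) + indicator (b₄ i) ≡ 1) →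
    count b₁ + count b₂ + count b₃ + count b₄ ≡ n
  count-partition {n} b₁ b₂ b₃ b₄ partition = begin
    count b₁ + count b₂ + count b₃ + count b₄
      ≡⟨ cong₂ _+_ (cong₂ _+_ (cong₂ _+_ (count≡sum b₁) (count≡sum b₂)) (count≡sum b₃)) (count≡sum b₄) ⟩
    ℕ∑.sum ι₁ + ℕ∑.sum ι₂ + ℕ∑.sum ι₃ + ℕ∑.sum ι₄
      ≡⟨ cong (_+ ℕ∑.sum ι₄) (cong (_+ ℕ∑.sum ι₃) (sym (ℕ∑.∑-distrib-+ ι₁ ι₂))) ⟩
    ℕ∑.sum (λ i → ι₁ i + ι₂ i) + ℕ∑.sum ι₃ + ℕ∑.sum ι₄
      ≡⟨ cong (_+ ℕ∑.sum ι₄) (sym (ℕ∑.∑-distrib-+ _ ι₃)) ⟩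
    ℕ∑.sum (λ i → ι₁ i + ι₂ i + ι₃ i) + ℕ∑.sum ι₄
      ≡⟨ sym (ℕ∑.∑-distrib-+ _ ι₄) ⟩
    ℕ∑.sum (λ i → ι₁ i + ι₂ i + ι₃ i + ι₄ i)
      ≡⟨ ℕ∑.sum-cong-≗ partition ⟩
    ℕ∑.sum {n} (λ _ → 1)
      ≡⟨ sum-ones n ⟩
    n ∎
    where
    open ≡-Reasoning
    ι₁ ι₂ ι₃ ι₄ : Fin n → ℕ
    ι₁ = indicator ∘ b₁
    ι₂ = indicator ∘ b₂
    ι₃ = indicator ∘ b₃
    ι₄ = indicator ∘ b₄

  colouredTest : ∀ {n r} → ((l e z : Bool) → Bool) → (Fin n → Fin n) → (Fin n → Fin r) → Fin n → Bool
  colouredTest b π c i = b (isExc π i) (isFix π i) (isUncoloured c i)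

  aexcA≡count : ∀ {n r} (π : Fin n → Fin n) (c : Fin n → Fin r) → aexcA π c ≡ count (colouredTest aexcᵇ π c)
  aexcA≡count {n} π c = begin
    n ∸ E ∸ F ∸ S               ≡⟨ cong (_∸ S) (ℕₚ.∸-+-assoc n E F) ⟩
    n ∸ (E + F) ∸ S             ≡⟨ ℕₚ.∸-+-assoc n (E + F) S ⟩
    n ∸ (E + F + S)             ≡⟨ cong (_∸ (E + F + S)) (sym partition) ⟩
    E + F + S + A ∸ (E + F + S) ≡⟨ ℕₚ.m+n∸m≡n (E + F + S) A ⟩
    A ∎
    where
    open ≡-Reasoning
    stat : ((l e z : Bool) → Bool) → Fin n → Bool
    stat b = colouredTest b π c
    E F S A : ℕ
    E = count (stat excᵇ)
    F = count (stat fixᵇ)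
    S = count (stat singleᵇ)
    A = count (stat aexcᵇ)
    partition : E + F + S + A ≡ n
    partition = count-partition (stat excᵇ) (stat fixᵇ) (stat singleᵇ) (stat aexcᵇ)
      (λ i → indicator-partition (trichotomous (toℕ i) (toℕ (π i))) (isUncoloured c i))

  foldr-+-map-tabulate : ∀ {n} {A : Set} (g : A → ℕ) (h : Fin n → A) →
    foldr _+_ 0 (map g (tabulate h)) ≡ ℕ∑.sum (g ∘ h)
  foldr-+-map-tabulate {zero}  g h = refl
  foldr-+-map-tabulate {suc n} g h = cong (g (h zero) +_) (foldr-+-map-tabulate g (h ∘ suc))

  csum≡sum : ∀ {n r} (π : Fin n → Fin n) (c : Fin n → Fin r) → csum π c ≡ ℕ∑.sum (toℕ ∘ c)
  csum≡sum π c = foldr-+-map-tabulate (toℕ ∘ c) id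

open Counting

module _ {c ℓ : Level} (R : CommutativeRing c ℓ) where
  open CommutativeRing R hiding (zero)
  open RingDefs R
  open import Relation.Binary.Reasoning.Setoid setoid
  open import Algebra.Properties.Semiring.Sum semiring using (sum; *-distribˡ-sum)
  open import Algebra.Properties.CommutativeMonoid.Sum *-commutativeMonoid using ()
    renaming (sum to ∏; sum-cong-≋ to ∏-cong; ∑-distrib-+ to ∏-distrib-*)
  open import Algebra.Solver.Ring.NaturalCoefficients.Default commutativeSemiring

  _^ᵇ_ : Carrier → Bool → Carrier
  a ^ᵇ b = if b then a else 1#

  pow-+ : ∀ a m n → pow a (m ℕ.+ n) ≈ pow a m * pow a n
  pow-+ a zero    n = sym (*-identityˡ _)
  pow-+ a (suc m) n = trans (*-congˡ (pow-+ a m n)) (sym (*-assoc _ _ _))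

  pow-sum : ∀ {n} a (f : Fin n → ℕ) → pow a (ℕ∑.sum f) ≈ ∏ (λ i → pow a (f i))
  pow-sum {zero}  a f = refl
  pow-sum {suc n} a f = trans (pow-+ a (f zero) _) (*-congˡ (pow-sum a (f ∘ suc)))

  pow-indicator : ∀ a b → pow a (indicator b) ≈ a ^ᵇ b
  pow-indicator a true  = *-identityʳ a
  pow-indicator a false = refl

  pow-count : ∀ {n} a (b : Fin n → Bool) → pow a (count b) ≈ ∏ (λ i → a ^ᵇ b i)
  pow-count a b = begin
    pow a (count b)                   ≡⟨ cong (pow a) (count≡sum b) ⟩
    pow a (ℕ∑.sum (indicator ∘ b))    ≈⟨ pow-sum a (indicator ∘ b) ⟩
    ∏ (λ i → pow a (indicator (b i))) ≈⟨ ∏-cong (λ i → pow-indicator a (b i)) ⟩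
    ∏ (λ i → a ^ᵇ b i) ∎

  Σl-cong : ∀ {A : Set} (xs : List A) {f g : A → Carrier} → (∀ a → f a ≈ g a) → Σl xs f ≈ Σl xs g
  Σl-cong []       f≈g = refl
  Σl-cong (x ∷ xs) f≈g = +-cong (f≈g x) (Σl-cong xs f≈g)

  Σl-++ : ∀ {A : Set} (xs ys : List A) (f : A → Carrier) → Σl (xs ++ ys) f ≈ Σl xs f + Σl ys f
  Σl-++ []       ys f = sym (+-identityˡ _)
  Σl-++ (x ∷ xs) ys f = trans (+-congˡ (Σl-++ xs ys f)) (sym (+-assoc _ _ _))

  Σl-map : ∀ {A B : Set} (h : A → B) (xs : List A) (f : B → Carrier) → Σl (map h xs) f ≈ Σl xs (f ∘ h)
  Σl-map h []       f = refl
  Σl-map h (x ∷ xs) f = +-congˡ (Σl-map h xs f)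

  Σl-concatMap : ∀ {A B : Set} (G : A → List B) (xs : List A) (f : B → Carrier) →
    Σl (concatMap G xs) f ≈ Σl xs (λ a → Σl (G a) f)
  Σl-concatMap G []       f = refl
  Σl-concatMap G (x ∷ xs) f = trans (Σl-++ (G x) (concatMap G xs) f) (+-congˡ (Σl-concatMap G xs f))

  Σl-*ˡ : ∀ {A : Set} (xs : List A) k (f : A → Carrier) → Σl xs (λ a → k * f a) ≈ k * Σl xs f
  Σl-*ˡ []       k f = sym (zeroʳ k)
  Σl-*ˡ (x ∷ xs) k f = trans (+-congˡ (Σl-*ˡ xs k f)) (sym (distribˡ _ _ _))

  Σl-*ʳ : ∀ {A : Set} (xs : List A) k (f : A → Carrier) → Σl xs (λ a → f a * k) ≈ Σl xs f * k
  Σl-*ʳ []       k f = sym (zeroˡ k)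
  Σl-*ʳ (x ∷ xs) k f = trans (+-congˡ (Σl-*ʳ xs k f)) (sym (distribʳ _ _ _))

  Σl-tabulate : ∀ {n} {A : Set} (h : Fin n → A) (f : A → Carrier) → Σl (tabulate h) f ≈ sum (f ∘ h)
  Σl-tabulate {zero}  h f = refl
  Σl-tabulate {suc n} h f = +-congˡ (Σl-tabulate (h ∘ suc) f)

  Σl-applyUpTo : ∀ m (h : ℕ → ℕ) (f : ℕ → Carrier) → Σl (applyUpTo h m) f ≈ sum (f ∘ h ∘ toℕ {m})
  Σl-applyUpTo zero    h f = refl
  Σl-applyUpTo (suc m) h f = +-congˡ (Σl-applyUpTo m (h ∘ suc) f)

  Σl-allFuns : ∀ n r (L : Fin n → Fin r → Carrier) →
    Σl (allFuns n r) (λ c → ∏ (λ i → L i (c i))) ≈ ∏ (λ i → Σl (allFin r) (L i))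
  Σl-allFuns zero    r L = +-identityʳ _
  Σl-allFuns (suc n) r L = begin
    Σl (allFuns (suc n) r) (λ c → ∏ (λ i → L i (c i)))
      ≈⟨ Σl-concatMap (λ a → map (a ∷ᶠ_) (allFuns n r)) (allFin r) _ ⟩
    Σl (allFin r) (λ a → Σl (map (a ∷ᶠ_) (allFuns n r)) (λ c → ∏ (λ i → L i (c i))))
      ≈⟨ Σl-cong (allFin r) (λ a → Σl-map (a ∷ᶠ_) (allFuns n r) _) ⟩
    Σl (allFin r) (λ a → Σl (allFuns n r) (λ c → L zero a * ∏ (λ i → L (suc i) (c i))))
      ≈⟨ Σl-cong (allFin r) (λ a → Σl-*ˡ (allFuns n r) (L zero a) _) ⟩
    Σl (allFin r) (λ a → L zero a * Σl (allFuns n r) (λ c → ∏ (λ i → L (suc i) (c i))))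
      ≈⟨ Σl-cong (allFin r) (λ a → *-congˡ (Σl-allFuns n r (L ∘ suc))) ⟩
    Σl (allFin r) (λ a → L zero a * ∏ (λ i → Σl (allFin r) (L (suc i))))
      ≈⟨ Σl-*ʳ (allFin r) _ (L zero) ⟩
    Σl (allFin r) (L zero) * ∏ (λ i → Σl (allFin r) (L (suc i))) ∎

  p*qint : ∀ m p → sum (λ j → pow p (suc (toℕ {m} j))) ≈ p * qint m p
  p*qint m p = begin
    sum (λ j → p * pow p (toℕ {m} j)) ≈⟨ sym (*-distribˡ-sum p (pow p ∘ toℕ {m})) ⟩
    p * sum (pow p ∘ toℕ {m})         ≈⟨ *-congˡ (sym (Σl-applyUpTo m id (pow p))) ⟩
    p * qint m p ∎

  qint-suc : ∀ m p → qint (suc m) p ≈ 1# + p * qint m p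
  qint-suc m p = +-congˡ (trans (Σl-applyUpTo m suc (pow p)) (p*qint m p))

  Σl-colours : ∀ m p (W : Bool → Carrier) →
    Σl (allFin (suc m)) (λ k → W (toℕ k ℕ.≡ᵇ 0) * pow p (toℕ k))
      ≈ W true * 1# + W false * (p * qint m p)
  Σl-colours m p W = +-congˡ (begin
    Σl (tabulate {n = m} suc) (λ k → W (toℕ k ℕ.≡ᵇ 0) * pow p (toℕ k))
      ≈⟨ Σl-tabulate {m} suc _ ⟩
    sum (λ j → W false * pow p (suc (toℕ {m} j)))
      ≈⟨ sym (*-distribˡ-sum (W false) (λ j → pow p (suc (toℕ {m} j)))) ⟩
    W false * sum (λ j → pow p (suc (toℕ {m} j)))
      ≈⟨ *-congˡ (p*qint m p) ⟩
    W false * (p * qint m p) ∎)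

  ∏-merge : ∀ {n} (f g : Fin n → Carrier) → ∏ f * ∏ g ≈ ∏ (λ i → f i * g i)
  ∏-merge f g = sym (∏-distrib-* f g)

  module _ (m : ℕ) (x y s t p q : Carrier) where
    excWeight dropWeight fixWeight : Carrier
    excWeight  = x + p * qint m p * y
    dropWeight = qint (suc m) p * y
    fixWeight  = t + s * p * qint m p

    weight : (l e z : Bool) → Carrier
    weight l e z = x ^ᵇ excᵇ l e z * y ^ᵇ aexcᵇ l e z * s ^ᵇ singleᵇ l e z * t ^ᵇ fixᵇ l e z

    colour-sum : ∀ {l e g} → Trichotomous l e g →
      Σl (allFin (suc m)) (λ k → weight l e (toℕ k ℕ.≡ᵇ 0) * pow p (toℕ k))
        ≈ excWeight ^ᵇ l * dropWeight ^ᵇ g * fixWeight ^ᵇ e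
    colour-sum less = trans (Σl-colours m p (weight true false))
      (solve 4 (λ x y p Q → x :* con 1 :* con 1 :* con 1 :* con 1 :+ con 1 :* y :* con 1 :* con 1 :* (p :* Q)
                 := (x :+ p :* Q :* y) :* con 1 :* con 1) refl x y p (qint m p))
    colour-sum equal = trans (Σl-colours m p (weight false true))
      (solve 4 (λ s t p Q → con 1 :* con 1 :* con 1 :* t :* con 1 :+ con 1 :* con 1 :* s :* con 1 :* (p :* Q)
                 := con 1 :* con 1 :* (t :+ s :* p :* Q)) refl s t p (qint m p))
    colour-sum greater = trans (Σl-colours m p (weight false false))
      (trans (solve 3 (λ y p Q → con 1 :* y :* con 1 :* con 1 :* con 1 :+ con 1 :* y :* con 1 :* con 1 :* (p :* Q)
                        := con 1 :* ((con 1 :+ p :* Q) :* y) :* con 1) refl y p (qint m p))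
             (*-congʳ (*-congˡ (*-congʳ (sym (qint-suc m p))))))

    colouredWeight-∏ : ∀ {n} (π : Fin n → Fin n) (c : Fin n → Fin (suc m)) →
      pow x (excA π c) * pow y (aexcA π c) * pow s (single π c) * pow t (fixC π c) * pow p (csum π c)
        ≈ ∏ (λ i → weight (isExc π i) (isFix π i) (isUncoloured c i) * pow p (toℕ (c i)))
    colouredWeight-∏ {n} π c = begin
      pow x (excA π c) * pow y (aexcA π c) * pow s (single π c) * pow t (fixC π c) * pow p (csum π c)
        ≈⟨ *-cong (*-cong (*-cong (*-cong (pow-count x (colouredTest excᵇ π c)) powY)
                                      (pow-count s (colouredTest singleᵇ π c)))
                             (pow-count t (colouredTest fixᵇ π c)))
                    powP ⟩
      ∏ X * ∏ Y * ∏ S * ∏ T * ∏ P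
        ≈⟨ *-congʳ (*-congʳ (*-congʳ (∏-merge X Y))) ⟩
      ∏ (λ i → X i * Y i) * ∏ S * ∏ T * ∏ P
        ≈⟨ *-congʳ (*-congʳ (∏-merge (λ i → X i * Y i) S)) ⟩
      ∏ (λ i → X i * Y i * S i) * ∏ T * ∏ P
        ≈⟨ *-congʳ (∏-merge (λ i → X i * Y i * S i) T) ⟩
      ∏ (λ i → X i * Y i * S i * T i) * ∏ P
        ≈⟨ ∏-merge (λ i → X i * Y i * S i * T i) P ⟩
      ∏ (λ i → X i * Y i * S i * T i * P i) ∎
      where
      X Y S T P : Fin n → Carrier
      X i = x ^ᵇ colouredTest excᵇ π c i
      Y i = y ^ᵇ colouredTest aexcᵇ π c i
      S i = s ^ᵇ colouredTest singleᵇ π c i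
      T i = t ^ᵇ colouredTest fixᵇ π c i
      P i = pow p (toℕ (c i))
      powY : pow y (aexcA π c) ≈ ∏ Y
      powY = trans (reflexive (cong (pow y) (aexcA≡count π c))) (pow-count y (colouredTest aexcᵇ π c))
      powP : pow p (csum π c) ≈ ∏ P
      powP = trans (reflexive (cong (pow p) (csum≡sum π c))) (pow-sum p (toℕ ∘ c))

    pow-stats-∏ : ∀ {n} (π : Fin n → Fin n) →
      pow excWeight (exc π) * pow dropWeight (drop π) * pow fixWeight (fix π)
        ≈ ∏ (λ i → excWeight ^ᵇ isExc π i * dropWeight ^ᵇ isDrop π i * fixWeight ^ᵇ isFix π i)
    pow-stats-∏ {n} π = trans (*-cong (*-cong (pow-count excWeight (isExc π)) (pow-count dropWeight (isDrop π)))
                                      (pow-count fixWeight (isFix π)))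
      (trans (*-congʳ (∏-merge A B)) (∏-merge (λ i → A i * B i) C))
      where
      A B C : Fin n → Carrier
      A i = excWeight ^ᵇ isExc π i
      B i = dropWeight ^ᵇ isDrop π i
      C i = fixWeight ^ᵇ isFix π i

    sum-over-colourings : ∀ {n} (π : Fin n → Fin n) →
      Σl (colourings n (suc m)) (λ c →
        pow x (excA π c) * pow y (aexcA π c) * pow s (single π c) * pow t (fixC π c) * pow p (csum π c) * pow q (cyc π))
        ≈ pow excWeight (exc π) * pow dropWeight (drop π) * pow fixWeight (fix π) * pow q (cyc π)
    sum-over-colourings {n} π = begin
      Σl (allFuns n (suc m)) (λ c →
        pow x (excA π c) * pow y (aexcA π c) * pow s (single π c) * pow t (fixC π c) * pow p (csum π c) * pow q (cyc π))
        ≈⟨ Σl-cong (allFuns n (suc m)) (λ c → *-congʳ (colouredWeight-∏ π c)) ⟩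
      Σl (allFuns n (suc m)) (λ c → ∏ (λ i → L i (c i)) * pow q (cyc π))
        ≈⟨ Σl-*ʳ (allFuns n (suc m)) _ _ ⟩
      Σl (allFuns n (suc m)) (λ c → ∏ (λ i → L i (c i))) * pow q (cyc π)
        ≈⟨ *-congʳ (Σl-allFuns n (suc m) L) ⟩
      ∏ (λ i → Σl (allFin (suc m)) (L i)) * pow q (cyc π)
        ≈⟨ *-congʳ (∏-cong (λ i → colour-sum (trichotomous (toℕ i) (toℕ (π i))))) ⟩
      ∏ (λ i → excWeight ^ᵇ isExc π i * dropWeight ^ᵇ isDrop π i * fixWeight ^ᵇ isFix π i) * pow q (cyc π)
        ≈⟨ *-congʳ (pow-stats-∏ π) ⟨
      pow excWeight (exc π) * pow dropWeight (drop π) * pow fixWeight (fix π) * pow q (cyc π) ∎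
      where
      L : Fin n → Fin (suc m) → Carrier
      L i k = weight (isExc π i) (isFix π i) (toℕ k ℕ.≡ᵇ 0) * pow p (toℕ k)

theorem51 : {c ℓ : Level} (R : CommutativeRing c ℓ) (r n : ℕ) → 1 ≤ r → 1 ≤ n →
    (x y s t p q : CommutativeRing.Carrier R) →
    CommutativeRing._≈_ R (RingDefs.Ar R n r x y s t p q) (RingDefs.RHS R n r x y s t p q)
theorem51 R zero    n () _ x y s t p q
theorem51 R (suc m) n _  _ x y s t p q = Σl-cong R (perms n) (sum-over-colourings R m x y s t p q)
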